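{- Let $\mathcal{M}$ be an $\mathit{LTL}$-model, $[n_1,\ldots,n_k]$ an observation sequence, $A^l$ an $\mathit{LTL}^l$-formula and $A^{l\nabla}$ an $\mathit{LTL}^{l\nabla}$-formula. Then: (i) $\mathcal{M},[n_1,\ldots,n_k]\models_\nabla A^l$ iff $\mathcal{M},[m_1,\ldots,m_r,n_k]\models_\nabla A^l$ for every sequence $m_1,\ldots,m_r$; and (ii) $\mathcal{M},[n_1,\ldots,n_{k-1},n_k]\models_\nabla A^{l\nabla}$ iff $\mathcal{M},[m_1,\ldots,m_r,n_{k-1},n_k]\models_\nabla A^{l\nabla}$ for every sequence $m_1,\ldots,m_r$.
   Context: Fix a set $\mathcal{P}$ of propositional symbols. $\mathit{LTL}_\nabla$-formulas: $A ::= p \mid \bot \mid A\supset A \mid \mathsf{G}A \mid \mathsf{X}A \mid \nabla A$ ($p\in\mathcal{P}$). The $\mathit{LTL}^l$-formulas $A^l$ and the $\mathit{LTL}^{l\nabla}$-formulas $A^{l\nabla}$ are the $\mathit{LTL}_\nabla$-formulas generated by the mutually recursive grammar $A^l ::= p \mid \bot \mid A^l\supset A^l \mid \mathsf{G}A^{l\nabla} \mid \mathsf{X}A^{l\nabla}$ and $A^{l\nabla} ::= A^l \mid A^{l\nabla}\supset A^{l\nabla} \mid \nabla A^{l\nabla}$. An $\mathit{LTL}$-model is $\mathcal{M}=\langle \mathbb{N},\mathcal{V}\rangle$ with $\mathcal{V}:\mathbb{N}\to 2^{\mathcal{P}}$. An observation sequence is a non-empty finite sequence $[n_0,\ldots,n_k]$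 of natural numbers. Truth $\models_\nabla$: $\mathcal{M},[n_0,\ldots,n_k]\models_\nabla p$ iff $p\in\mathcal{V}(n_k)$; $\bot$ never true; $\supset$ classical at the same sequence; $\mathcal{M},[n_0,\ldots,n_k]\models_\nabla\mathsf{G}A$ iff $\mathcal{M},[n_0,\ldots,n_k,m]\models_\nabla A$ for all $m\ge n_k$; $\mathcal{M},[n_0,\ldots,n_k]\models_\nabla\mathsf{X}A$ iff $\mathcal{M},[n_0,\ldots,n_k,n_k+1]\models_\nabla A$; if $k>0$, $\mathcal{M},[n_0,\ldots,n_{k-1},n_k]\models_\nabla\nabla A$ iff $\mathcal{M},[n_0,\ldots,n_{k-1},m]\models_\nabla A$ for all $n_{k-1}\le m\le n_k$; and $\mathcal{M},[n_0]\models_\nabla\nabla A$ iff $\mathcal{M},[n_0]\models_\nabla A$. -}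

module Defs where

open import Data.Nat using (ℕ; suc; _≤_)
open import Data.Bool using (Bool; true)
open import Data.List using (List; []; _∷_; reverse)
open import Data.Empty using (⊥)
open import Relation.Binary.PropositionalEquality using (_≡_)

data Formula (P : Set) : Set where
  var  : P → Formula P
  bot  : Formula P
  _⊃_  : Formula P → Formula P → Formula P
  G    : Formula P → Formula P
  X    : Formula P → Formula P
  ∇    : Formula P → Formula P

infixr 5 _⊃_

mutual
  data IsL {P : Set} : Formula P → Set where
    l-var : ∀ p → IsL (var p)
    l-bot : IsL bot
    l-imp : ∀ {A B} → IsL A → IsL B → IsL (A ⊃ B)
    l-G   : ∀ {A} → IsL∇ A → IsL (G A)
    l-X   : ∀ {A} → IsL∇ A → IsL (X A)

  data IsL∇ {P : Set} : Formula P → Set where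
    l∇-l   : ∀ {A} → IsL A → IsL∇ A
    l∇-imp : ∀ {A B} → IsL∇ A → IsL∇ B → IsL∇ (A ⊃ B)
    l∇-∇   : ∀ {A} → IsL∇ A → IsL∇ (∇ A)

-- An LTL-model: a valuation V : ℕ → 2^P, given as a characteristic function.
record Model (P : Set) : Set where
  field
    V : ℕ → P → Bool

-- Auxiliary truth relation on REVERSED observation sequences:
-- satR M n rs A  means  M , (reverse rs ++ [n]) ⊨∇ A,
-- i.e. n is the last element and rs lists the earlier elements, latest first.
satR : {P : Set} → Model P → ℕ → List ℕ → Formula P → Set
satR M n rs (var p) = Model.V M n p ≡ true
satR M n rs bot = ⊥
satR M n rs (A ⊃ B) = satR M n rs A → satR M n rs B
satR M n rs (G A) = ∀ m → n ≤ m → satR M m (n ∷ rs) A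
satR M n rs (X A) = satR M (suc n) (n ∷ rs) A
satR M n [] (∇ A) = satR M n [] A
satR M n (p ∷ rs) (∇ A) = ∀ m → p ≤ m → m ≤ n → satR M m (p ∷ rs) A

-- M , [n₀ , … , n_{k-1} , n] ⊨∇ A, where ns = [n₀ , … , n_{k-1}] (possibly empty)
-- is the prefix in natural order and n the last element of the sequence.
_,_∷ʳ_⊨∇_ : {P : Set} → Model P → List ℕ → ℕ → Formula P → Set
M , ns ∷ʳ n ⊨∇ A = satR M n (reverse ns) A

-- An LTL^l formula reads only the last point of the sequence and an LTL^{l∇} formula
-- only the last two (∇ ranges between them).  G and X append a new point, so their
-- bodies see just the current point plus the one they added; induction on the
-- mutual grammar therefore never reaches the earlier history.

module Submission where

open import Defs
open import Data.Nat using (ℕ)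
open import Data.List using (List; _∷ʳ_; _∷_; []; reverse)
open import Data.List.Properties using (reverse-++)
open import Data.Product using (_×_; _,_)
open import Function.Bundles using (_⇔_; mk⇔)
open import Relation.Binary.PropositionalEquality using (_≡_; subst; sym)

reverse-∷ʳ : {A : Set} (xs : List A) (x : A) → reverse (xs ∷ʳ x) ≡ x ∷ reverse xs
reverse-∷ʳ xs x = reverse-++ xs (x ∷ [])

module _ {P : Set} (M : Model P) where

  mutual
    L-history-irrelevant : ∀ {A} → IsL A → ∀ n rs rs′ → satR M n rs A → satR M n rs′ A
    L-history-irrelevant (l-var p)   n rs rs′ h   = h
    L-history-irrelevant l-bot       n rs rs′ h   = h
    L-history-irrelevant (l-imp a b) n rs rs′ h x =
      L-history-irrelevant b n rs rs′ (h (L-history-irrelevant a n rs′ rs x))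
    L-history-irrelevant (l-G a)     n rs rs′ h m n≤m =
      L∇-history-irrelevant a m n rs rs′ (h m n≤m)
    L-history-irrelevant (l-X a)     n rs rs′ h   =
      L∇-history-irrelevant a _ n rs rs′ h

    L∇-history-irrelevant : ∀ {A} → IsL∇ A → ∀ n p rs rs′ →
                            satR M n (p ∷ rs) A → satR M n (p ∷ rs′) A
    L∇-history-irrelevant (l∇-l a)     n p rs rs′ h   =
      L-history-irrelevant a n (p ∷ rs) (p ∷ rs′) h
    L∇-history-irrelevant (l∇-imp a b) n p rs rs′ h x =
      L∇-history-irrelevant b n p rs rs′ (h (L∇-history-irrelevant a n p rs′ rs x))
    L∇-history-irrelevant (l∇-∇ a)     n p rs rs′ h m p≤m m≤n =
      L∇-history-irrelevant a m p rs rs′ (h m p≤m m≤n)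

  L-prefix-irrelevant : ∀ {A} → IsL A → ∀ ns ms n → M , ns ∷ʳ n ⊨∇ A → M , ms ∷ʳ n ⊨∇ A
  L-prefix-irrelevant a ns ms n = L-history-irrelevant a n (reverse ns) (reverse ms)

  L∇-prefix-irrelevant : ∀ {A} → IsL∇ A → ∀ ns ms p n →
                         M , (ns ∷ʳ p) ∷ʳ n ⊨∇ A → M , (ms ∷ʳ p) ∷ʳ n ⊨∇ A
  L∇-prefix-irrelevant {A} a ns ms p n h =
    subst (λ rs → satR M n rs A) (sym (reverse-∷ʳ ms p))
      (L∇-history-irrelevant a n p (reverse ns) (reverse ms)
        (subst (λ rs → satR M n rs A) (reverse-∷ʳ ns p) h))

lemma3 : {P : Set} (M : Model P) →
    (∀ (ns : List ℕ) (nk : ℕ) (A : Formula P) → IsL A → (ms : List ℕ) →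
    ((M , ns ∷ʳ nk ⊨∇ A) ⇔ (M , ms ∷ʳ nk ⊨∇ A)))
    ×
    (∀ (ns : List ℕ) (nk₁ nk : ℕ) (A : Formula P) → IsL∇ A → (ms : List ℕ) →
    ((M , (ns ∷ʳ nk₁) ∷ʳ nk ⊨∇ A) ⇔ (M , (ms ∷ʳ nk₁) ∷ʳ nk ⊨∇ A)))
lemma3 M =
  (λ ns nk A a ms → mk⇔ (L-prefix-irrelevant M a ns ms nk) (L-prefix-irrelevant M a ms ns nk)) ,
  (λ ns nk₁ nk A a ms →
    mk⇔ (L∇-prefix-irrelevant M a ns ms nk₁ nk) (L∇-prefix-irrelevant M a ms ns nk₁ nk))
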